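{- As $n \to \infty$, we have $\overrightarrow{\omega}(A_n) \to \infty$ and $\overrightarrow{\omega}(D_n) \to \infty$.
   Context: A tournament is a finite directed graph with exactly one arc between each pair of distinct vertices. For a total ordering $<$ of $V(T)$, the backedge graph $B(T,<)$ is the graph on $V(T)$ with an edge $uv$ for every pair $u<v$ with $vu \in A(T)$. The clique number of a tournament is $\overrightarrow{\omega}(T)=\min_{<}\omega(B(T,<))$ over all total orderings of $V(T)$. For disjoint vertex sets $X,Y$, $X \Rightarrow Y$ means $xy\in A(T)$ for all $x\in X$, $y \in Y$. The tournament $A_1$ is a single vertex; for $n\ge 2$, $A_n$ consists of vertex-disjoint tournaments $T_1,\dots,T_{n-1}$, each isomorphic to $A_{n-1}$, and further vertices $v_1,\dots,v_n$, with: $A_n[V(T_i)]=T_i$; $v_j\Rightarrow v_i$ whenever $i<j$; $V(T_i)\Rightarrow V(T_j)$ whenever $i<j$; $v_i\Rightarrow V(T_j)$ whenever $i\le j$; and $V(T_j)\Rightarrow v_i$ whenever $i>j$. The tournament $D_1$ is a single vertex, and $D_n$ is obtained from two disjoint copies $T_1,T_2$ of $D_{n-1}$ and one further vertex $w$ with $V(T_1)\Rightarrow V(T_2)$, $V(T_2)\Rightarrow w$, $w \Rightarrow V(T_1)$. -}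

module Defs where

open import Data.Nat using (ℕ; zero; suc; _≤_; _<_)
open import Data.Fin using (Fin; toℕ)
open import Data.Unit using (⊤)
open import Data.Empty using (⊥)
open import Data.Sum using (_⊎_; inj₁; inj₂)
open import Data.Product using (Σ; _×_)
open import Relation.Binary.PropositionalEquality using (_≡_; _≢_)
open import Relation.Binary.Structures using (IsStrictTotalOrder)

BEdge : {V : Set} → (V → V → Set) → (V → V → Set) → V → V → Set
BEdge arc _≺_ u v = (u ≺ v × arc v u) ⊎ (v ≺ u × arc u v)

HasClique : {V : Set} → (V → V → Set) → ℕ → Set
HasClique {V} adj k =
  Σ (Fin k → V) λ f → (i j : Fin k) → i ≢ j → adj (f i) (f j)

-- ω⃗(T) ≥ k  :⇔  min over total orderings < of ω(B(T,<)) is ≥ k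
--            ⇔  for every total ordering <, B(T,<) has a clique of size k.
CliqueNumber≥ : (V : Set) → (V → V → Set) → ℕ → Set₁
CliqueNumber≥ V arc k =
  (_≺_ : V → V → Set) → IsStrictTotalOrder _≡_ _≺_ →
  HasClique (BEdge arc _≺_) k

-- Index shift: AV n / AArc n is A_{n+1}.
-- A_{n+2} has copies T_1..T_{n+1} of A_{n+1} (indexed by Fin (suc n),
-- 0-based) and vertices v_1..v_{n+2} (indexed by Fin (suc (suc n))).

AV : ℕ → Set
AV zero    = ⊤
AV (suc n) = (Fin (suc n) × AV n) ⊎ Fin (suc (suc n))

AArc : (n : ℕ) → AV n → AV n → Set
AArc zero    _ _ = ⊥
AArc (suc n) (inj₁ (i Data.Product., x)) (inj₁ (j Data.Product., y)) =
  toℕ i < toℕ j ⊎ (i ≡ j × AArc n x y)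
AArc (suc n) (inj₂ i) (inj₂ j) = toℕ j < toℕ i
AArc (suc n) (inj₂ i) (inj₁ (j Data.Product., y)) = toℕ i ≤ toℕ j
AArc (suc n) (inj₁ (j Data.Product., y)) (inj₂ i) = toℕ j < toℕ i

-- The tournaments D_n.  Index shift: DV n / DArc n is D_{n+1}.
-- D_{n+2} = T_1 (inj₁ (inj₁ _)), T_2 (inj₁ (inj₂ _)), w (inj₂ _).

DV : ℕ → Set
DV zero    = ⊤
DV (suc n) = (DV n ⊎ DV n) ⊎ ⊤

DArc : (n : ℕ) → DV n → DV n → Set
DArc zero    _ _ = ⊥
DArc (suc n) (inj₁ (inj₁ x)) (inj₁ (inj₁ y)) = DArc n x y
DArc (suc n) (inj₁ (inj₂ x)) (inj₁ (inj₂ y)) = DArc n x y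
DArc (suc n) (inj₁ (inj₁ x)) (inj₁ (inj₂ y)) = ⊤
DArc (suc n) (inj₁ (inj₂ x)) (inj₁ (inj₁ y)) = ⊥
DArc (suc n) (inj₁ (inj₂ x)) (inj₂ _)        = ⊤
DArc (suc n) (inj₂ _)        (inj₁ (inj₂ y)) = ⊥
DArc (suc n) (inj₂ _)        (inj₁ (inj₁ y)) = ⊤
DArc (suc n) (inj₁ (inj₁ x)) (inj₂ _)        = ⊥
DArc (suc n) (inj₂ _)        (inj₂ _)        = ⊥

-- Both families have a Ramsey property: every 2-colouring of the vertices of
-- D_N (resp. A_N), with N large compared with a + b, contains a copy of D_a
-- (resp. A_a) in the first colour or of D_b (resp. A_b) in the second.  Fix an
-- ordering of D_{2m+1} and colour its halves T_1, T_2 by the side of w their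
-- vertices lie on.  This yields a copy of D_m all of whose vertices are joined
-- by backedges to w, or to a vertex of T_2 below w, so every clique of the
-- copy's backedge graph grows by one vertex.  In A_N either v_1 < ... < v_N,
-- and then the v_i form a clique of the backedge graph, or v_j < v_i for some
-- i < j; colouring T_i by the side of v_j then yields a copy of A_m, m ≈ N/2,
-- joined by backedges to v_i or to v_j.
module Submission where

open import Defs
open import Data.Bool using (Bool; true; false; not)
open import Data.Bool.Properties using (¬-not; not-involutive) renaming (_≟_ to _≟ᵇ_)
open import Data.Empty using (⊥)
open import Data.Fin as Fin using (Fin; zero; suc; toℕ; fromℕ; fromℕ<; inject₁; inject≤; _<_)
open import Data.Fin.Properties
  using (toℕ<n; toℕ≤pred[n]; toℕ-fromℕ; toℕ-fromℕ<; toℕ-inject₁; toℕ-injective; inject≤-injective; any?; <⇒≢)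
  renaming (<-cmp to <-cmpᶠ; _<?_ to _<ᶠ?_)
open import Data.Nat as ℕ using (ℕ; zero; suc; _+_; _≤_; _≤′_; ≤′-refl; ≤′-step; s≤s; s<s; z<s; s≤s⁻¹)
open import Data.Nat.Properties
  using (≤-refl; ≤-reflexive; ≤-trans; <-≤-trans; ≤-<-trans; <⇒≤; +-suc; +-comm; ≤⇒≤′;
         m≤n⇒m<n∨m≡n; m≤n⇒m≤1+n; m≤n⇒m≤o+n; m≤m+n; m≤n+m; m+n≤o⇒n≤o)
open import Data.Product using (Σ; ∃-syntax; _×_; _,_; proj₁; proj₂; map₂)
open import Data.Product.Properties using (,-injective)
open import Data.Sum using (_⊎_; inj₁; inj₂; swap) renaming (map to ⊎-map)
open import Data.Sum.Properties using (inj₁-injective; inj₂-injective)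
open import Data.Unit using (⊤; tt)
open import Function using (_∘_)
open import Level using (0ℓ)
open import Relation.Binary.Core using (Rel; _Preserves_⟶_)
open import Relation.Binary.Definitions using (Tri; tri<; tri≈; tri>)
open import Relation.Binary.PropositionalEquality
  using (_≡_; _≢_; refl; sym; trans; cong; subst; subst₂; isEquivalence)
open import Relation.Binary.Structures using (IsStrictTotalOrder)
open import Relation.Nullary using (yes; no; does; contradiction)
open import Relation.Nullary.Decidable using (_×-dec_)

private
  variable
    U V W : Set
    k m n : ℕ

record Embedding {V W : Set} (S : Rel V 0ℓ) (T : Rel W 0ℓ) : Set where
  field
    to        : V → W
    injective : ∀ {x y} → to x ≡ to y → x ≡ y
    homo      : ∀ {x y} → S x y → T (to x) (to y)
open Embedding public

idᴱ : {S : Rel V 0ℓ} → Embedding S S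
idᴱ = record { to = λ x → x ; injective = λ eq → eq ; homo = λ a → a }

_∘ᴱ_ : {R : Rel U 0ℓ} {S : Rel V 0ℓ} {T : Rel W 0ℓ} → Embedding S T → Embedding R S → Embedding R T
f ∘ᴱ g = record
  { to        = to f ∘ to g
  ; injective = injective g ∘ injective f
  ; homo      = homo f ∘ homo g
  }

vertex : {T : Rel W 0ℓ} → W → Embedding {⊤} (λ _ _ → ⊥) T
vertex w = record { to = λ _ → w ; injective = λ _ → refl ; homo = λ () }

pullback-isStrictTotalOrder : {_≺_ : Rel W 0ℓ} (g : V → W) → (∀ {x y} → g x ≡ g y → x ≡ y) →
  IsStrictTotalOrder _≡_ _≺_ → IsStrictTotalOrder _≡_ (λ x y → g x ≺ g y)
pullback-isStrictTotalOrder {_≺_ = _≺_} g g-injective sto = record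
  { isStrictPartialOrder = record
    { isEquivalence = isEquivalence
    ; irrefl        = λ { refl → irrefl refl }
    ; trans         = ≺-trans
    ; <-resp-≈      = (λ { refl p → p }) , (λ { refl p → p })
    }
  ; compare = compare′
  }
  where
  open IsStrictTotalOrder sto using (irrefl; compare) renaming (trans to ≺-trans)
  compare′ : ∀ x y → Tri (g x ≺ g y) (x ≡ y) (g y ≺ g x)
  compare′ x y with compare (g x) (g y)
  ... | tri< a ¬b ¬c = tri< a (¬b ∘ cong g) ¬c
  ... | tri≈ ¬a b ¬c = tri≈ ¬a (g-injective b) ¬c
  ... | tri> ¬a ¬b c = tri> ¬a (¬b ∘ cong g) c

module _ {_≺_ : Rel W 0ℓ} (sto : IsStrictTotalOrder _≡_ _≺_) where
  open IsStrictTotalOrder sto using (_<?_; compare)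

  does-<?-true : ∀ {x z} → does (x <? z) ≡ true → x ≺ z
  does-<?-true {x} {z} eq with compare x z
  ... | tri< x≺z _ _ = x≺z

  does-<?-false : ∀ {x z} → x ≢ z → does (x <? z) ≡ false → z ≺ x
  does-<?-false {x} {z} x≢z eq with compare x z
  ... | tri≈ _ x≡z _ = contradiction x≡z x≢z
  ... | tri> _ _ z≺x = z≺x

cliqueNumber≥-zero : {T : Rel V 0ℓ} → CliqueNumber≥ V T 0
cliqueNumber≥-zero _ _ = (λ ()) , λ ()

HasClique-≤ : {adj : Rel V 0ℓ} → k ≤ m → HasClique adj m → HasClique adj k
HasClique-≤ k≤m (K , K-adj) =
  K ∘ (λ i → inject≤ i k≤m) ,
  λ i j i≢j → K-adj _ _ (i≢j ∘ inject≤-injective k≤m k≤m i j)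

module _ {S : Rel V 0ℓ} {T : Rel W 0ℓ} (e : Embedding S T) where

  embedded-clique : CliqueNumber≥ V S k →
    {_≺_ : Rel W 0ℓ} → IsStrictTotalOrder _≡_ _≺_ →
    Σ (Fin k → V) λ K → ∀ i j → i ≢ j → BEdge T _≺_ (to e (K i)) (to e (K j))
  embedded-clique ω≥k {_≺_} sto
    with ω≥k (λ x y → to e x ≺ to e y) (pullback-isStrictTotalOrder (to e) (injective e) sto)
  ... | K , K-adj = K , λ i j i≢j → ⊎-map (map₂ (homo e)) (map₂ (homo e)) (K-adj i j i≢j)

  cliqueNumber≥-embedding : CliqueNumber≥ V S k → CliqueNumber≥ W T k
  cliqueNumber≥-embedding ω≥k _≺_ sto with embedded-clique ω≥k sto
  ... | K , K-adj = to e ∘ K , K-adj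

  cone : CliqueNumber≥ V S k → {_≺_ : Rel W 0ℓ} → IsStrictTotalOrder _≡_ _≺_ →
    (z : W) → (∀ x → BEdge T _≺_ z (to e x)) → HasClique (BEdge T _≺_) (suc k)
  cone {k} ω≥k {_≺_} sto z z-adj with embedded-clique ω≥k sto
  ... | K , K-adj = F , F-adj
    where
    F : Fin (suc k) → W
    F zero    = z
    F (suc i) = to e (K i)
    F-adj : ∀ i j → i ≢ j → BEdge T _≺_ (F i) (F j)
    F-adj zero    zero    i≢j = contradiction refl i≢j
    F-adj zero    (suc j) _   = z-adj (K j)
    F-adj (suc i) zero    _   = swap (z-adj (K i))
    F-adj (suc i) (suc j) i≢j = K-adj i j (i≢j ∘ cong suc)

module _ {V : ℕ → Set} {T : ∀ n → Rel (V n) 0ℓ} (step : ∀ n → Embedding (T n) (T (suc n))) where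

  chain-embedding : m ≤′ n → Embedding (T m) (T n)
  chain-embedding ≤′-refl        = idᴱ
  chain-embedding (≤′-step m≤′n) = step _ ∘ᴱ chain-embedding m≤′n

  cliqueNumber≥-upward : CliqueNumber≥ (V m) (T m) k → ∀ n → m ≤ n → CliqueNumber≥ (V n) (T n) k
  cliqueNumber≥-upward ω≥k n m≤n = cliqueNumber≥-embedding (chain-embedding (≤⇒≤′ m≤n)) ω≥k

Copy : {V W : Set} → Rel V 0ℓ → Rel W 0ℓ → (W → Bool) → Bool → Set
Copy S T c β = Σ (Embedding S T) λ e → ∀ x → c (to e x) ≡ β

Copy-∘ : {R : Rel U 0ℓ} {S : Rel V 0ℓ} {T : Rel W 0ℓ} {c : W → Bool} {β : Bool} →
  (e : Embedding S T) → Copy R S (c ∘ to e) β → Copy R T c β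
Copy-∘ e (e′ , e′-colour) = e ∘ᴱ e′ , e′-colour

D-left D-right : Embedding (DArc n) (DArc (suc n))
D-left  = record { to = inj₁ ∘ inj₁ ; injective = λ { refl → refl } ; homo = λ a → a }
D-right = record { to = inj₁ ∘ inj₂ ; injective = λ { refl → refl } ; homo = λ a → a }

D-apex : DV (suc n)
D-apex = inj₂ tt

D-vertex : ∀ n → DV n
D-vertex zero    = tt
D-vertex (suc n) = D-apex

D-join : Embedding (DArc m) (DArc n) → Embedding (DArc m) (DArc n) → Embedding (DArc (suc m)) (DArc (suc n))
D-join {m} {n} e₁ e₂ = record { to = f ; injective = λ {x} {y} → f-injective {x} {y} ; homo = λ {x} {y} → f-homo {x} {y} }
  where
  f : DV (suc m) → DV (suc n)
  f (inj₁ (inj₁ x)) = inj₁ (inj₁ (to e₁ x))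
  f (inj₁ (inj₂ x)) = inj₁ (inj₂ (to e₂ x))
  f (inj₂ _)        = D-apex
  f-injective : ∀ {x y} → f x ≡ f y → x ≡ y
  f-injective {inj₁ (inj₁ x)} {inj₁ (inj₁ y)} eq =
    cong (inj₁ ∘ inj₁) (injective e₁ (inj₁-injective (inj₁-injective eq)))
  f-injective {inj₁ (inj₂ x)} {inj₁ (inj₂ y)} eq =
    cong (inj₁ ∘ inj₂) (injective e₂ (inj₂-injective (inj₁-injective eq)))
  f-injective {inj₂ tt} {inj₂ tt} _ = refl
  f-injective {inj₂ tt} {inj₁ (inj₁ _)} ()
  f-injective {inj₂ tt} {inj₁ (inj₂ _)} ()
  f-homo : ∀ {x y} → DArc (suc m) x y → DArc (suc n) (f x) (f y)
  f-homo {inj₁ (inj₁ x)} {inj₁ (inj₁ y)} a = homo e₁ a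
  f-homo {inj₁ (inj₂ x)} {inj₁ (inj₂ y)} a = homo e₂ a
  f-homo {inj₁ (inj₁ x)} {inj₁ (inj₂ y)} a = a
  f-homo {inj₁ (inj₂ x)} {inj₂ _}        a = a
  f-homo {inj₂ _}        {inj₁ (inj₁ y)} a = a

D-Ramsey : ℕ → ℕ → ℕ → Set
D-Ramsey N a b = (c : DV N → Bool) (β : Bool) → Copy (DArc a) (DArc N) c β ⊎ Copy (DArc b) (DArc N) c (not β)

D-ramsey-apex : (∀ {a b} → a + b ≤ n → D-Ramsey n a b) →
  ∀ {a b} → a + b ≤ suc n → (c : DV (suc n) → Bool) (β : Bool) → c D-apex ≡ β →
  Copy (DArc a) (DArc (suc n)) c β ⊎ Copy (DArc b) (DArc (suc n)) c (not β)
D-ramsey-apex ih {zero} _ c β apex-β = inj₁ (vertex D-apex , λ _ → apex-β)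
D-ramsey-apex ih {suc a} a+b≤n c β apex-β
  with ih (s≤s⁻¹ a+b≤n) (c ∘ to D-left) β | ih (s≤s⁻¹ a+b≤n) (c ∘ to D-right) β
... | inj₂ copy | _         = inj₂ (Copy-∘ {c = c} D-left copy)
... | inj₁ _    | inj₂ copy = inj₂ (Copy-∘ {c = c} D-right copy)
... | inj₁ (e₁ , e₁-β) | inj₁ (e₂ , e₂-β) = inj₁ (D-join e₁ e₂ , colour)
  where
  colour : ∀ x → c (to (D-join e₁ e₂) x) ≡ β
  colour (inj₁ (inj₁ x)) = e₁-β x
  colour (inj₁ (inj₂ x)) = e₂-β x
  colour (inj₂ _)        = apex-β

-- If w does not have colour β it has colour not β, and the apex case applies
-- with the colours and the sizes exchanged.
D-ramsey : ∀ {N a b} → a + b ≤ N → D-Ramsey N a b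
D-ramsey {zero} {zero} {zero} _ c β with c tt ≟ᵇ β
... | yes c≡β = inj₁ (vertex tt , λ _ → c≡β)
... | no  c≢β = inj₂ (vertex tt , λ _ → ¬-not c≢β)
D-ramsey {suc N} {a} {b} a+b≤N c β with c D-apex ≟ᵇ β
... | yes apex-β = D-ramsey-apex (D-ramsey {N}) a+b≤N c β apex-β
... | no  apex-β =
  swap (⊎-map (λ copy → copy) (λ { (e , e-colour) → e , λ x → trans (e-colour x) (not-involutive β) })
    (D-ramsey-apex (D-ramsey {N}) (subst (_≤ suc N) (+-comm a b) a+b≤N) c (not β) (¬-not apex-β)))

module _ {n : ℕ} {_≺_ : Rel (DV (suc (n + n))) 0ℓ} (sto : IsStrictTotalOrder _≡_ _≺_) where
  open IsStrictTotalOrder sto using (_<?_) renaming (trans to ≺-trans)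

  D-clique-step : CliqueNumber≥ (DV n) (DArc n) k → HasClique (BEdge (DArc (suc (n + n))) _≺_) (suc k)
  D-clique-step ω≥k with D-ramsey ≤-refl (λ x → does (to D-left x <? D-apex)) true
  ... | inj₁ (e , below) =
    cone (D-left ∘ᴱ e) ω≥k sto D-apex (λ x → inj₂ (does-<?-true sto (below x) , tt))
  ... | inj₂ (e , above) with D-ramsey ≤-refl (λ y → does (to D-right y <? D-apex)) true
  ...   | inj₂ (e₂ , above₂) =
    cone (D-right ∘ᴱ e₂) ω≥k sto D-apex (λ y → inj₁ (does-<?-false sto (λ ()) (above₂ y) , tt))
  ...   | inj₁ (e₂ , below₂) =
    cone (D-left ∘ᴱ e) ω≥k sto (to (D-right ∘ᴱ e₂) (D-vertex n))
      (λ x → inj₁ (≺-trans (does-<?-true sto (below₂ _)) (does-<?-false sto (λ ()) (above x)) , tt))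

D-bound : ℕ → ℕ
D-bound zero    = 0
D-bound (suc k) = suc (D-bound k + D-bound k)

D-cliqueNumber≥ : ∀ k → CliqueNumber≥ (DV (D-bound k)) (DArc (D-bound k)) k
D-cliqueNumber≥ zero    = cliqueNumber≥-zero {T = DArc 0}
D-cliqueNumber≥ (suc k) _≺_ sto = D-clique-step sto (D-cliqueNumber≥ k)

Selection : (Fin n → Bool) → Bool → ℕ → Set
Selection {n} c β p = Σ (Fin p → Fin n) λ s → s Preserves _<_ ⟶ _<_ × (∀ i → c (s i) ≡ β)

module _ {c : Fin (suc n) → Bool} {β : Bool} where

  Selection-suc : ∀ {p} → Selection (c ∘ suc) β p → Selection c β p
  Selection-suc (s , s-mono , s-β) = suc ∘ s , s<s ∘ s-mono , s-β

  Selection-cons : ∀ {p} → c zero ≡ β → Selection (c ∘ suc) β p → Selection c β (suc p)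
  Selection-cons {p} c₀-β (s , s-mono , s-β) = s′ , s′-mono , s′-β
    where
    s′ : Fin (suc p) → Fin (suc n)
    s′ zero    = zero
    s′ (suc i) = suc (s i)
    s′-mono : s′ Preserves _<_ ⟶ _<_
    s′-mono {zero}  {suc j} _         = z<s
    s′-mono {suc i} {suc j} (s<s i<j) = s<s (s-mono i<j)
    s′-β : ∀ i → c (s′ i) ≡ β
    s′-β zero    = c₀-β
    s′-β (suc i) = s-β i

monochromatic-selection : ∀ p q → p + q ≤ suc n → (c : Fin n → Bool) (β : Bool) →
  Selection c β p ⊎ Selection c (not β) q
monochromatic-selection zero    q       _ c β = inj₁ ((λ ()) , (λ { {()} }) , λ ())
monochromatic-selection (suc p) zero    _ c β = inj₂ ((λ ()) , (λ { {()} }) , λ ())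
monochromatic-selection {zero} (suc p) (suc q) le c β with () ← m+n≤o⇒n≤o p (s≤s⁻¹ le)
monochromatic-selection {suc n} (suc p) (suc q) le c β with c zero ≟ᵇ β
... | yes c₀-β = ⊎-map (Selection-cons {c = c} c₀-β) (Selection-suc {c = c})
                   (monochromatic-selection p (suc q) (s≤s⁻¹ le) (c ∘ suc) β)
... | no  c₀-β = ⊎-map (Selection-suc {c = c}) (Selection-cons {c = c} (¬-not c₀-β))
                   (monochromatic-selection (suc p) q (subst (_≤ suc n) (+-suc p q) (s≤s⁻¹ le)) (c ∘ suc) β)

module _ {p} {s : Fin p → Fin n} (s-mono : s Preserves _<_ ⟶ _<_) where

  strictMono⇒injective : ∀ {i j} → s i ≡ s j → i ≡ j
  strictMono⇒injective {i} {j} eq with <-cmpᶠ i j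
  ... | tri< i<j _ _ = contradiction eq (<⇒≢ (s-mono i<j))
  ... | tri≈ _ i≡j _ = i≡j
  ... | tri> _ _ j<i = contradiction (sym eq) (<⇒≢ (s-mono j<i))

  strictMono⇒mono : ∀ {i j} → i Fin.≤ j → s i Fin.≤ s j
  strictMono⇒mono {i} {j} i≤j with m≤n⇒m<n∨m≡n i≤j
  ... | inj₁ i<j = <⇒≤ (s-mono i<j)
  ... | inj₂ i≡j = ≤-reflexive (cong (toℕ ∘ s) (toℕ-injective i≡j))

lowerBelow : {i j : Fin (suc n)} → i < j → Fin n
lowerBelow {j = j} i<j = fromℕ< (<-≤-trans i<j (toℕ≤pred[n] j))

toℕ-lowerBelow : {i j : Fin (suc n)} (i<j : i < j) → toℕ (lowerBelow i<j) ≡ toℕ i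
toℕ-lowerBelow i<j = toℕ-fromℕ< _

A-block : Fin (suc n) → Embedding (AArc n) (AArc (suc n))
A-block i = record { to = inj₁ ∘ (i ,_) ; injective = λ { refl → refl } ; homo = λ a → inj₂ (refl , a) }

-- ACopy c β a is a β-coloured copy of A_a, where A_0 is empty and AArc a is A_{a+1}.
ACopy : (AV m → Bool) → Bool → ℕ → Set
ACopy     c β zero    = ⊤
ACopy {m} c β (suc a) = Copy (AArc a) (AArc m) c β

ACopy-block : ∀ {a} {c : AV (suc n) → Bool} {β} (i : Fin (suc n)) →
  ACopy (c ∘ to (A-block i)) β a → ACopy c β a
ACopy-block {a = zero}  i _    = tt
ACopy-block {a = suc a} {c = c} i copy = Copy-∘ {c = c} (A-block i) copy

-- A_{a+2} inside A_{M+2}: v_q goes to v_{s q} and the block T_p, along the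
-- copy E, into the block with index t p = s p, which exists as s p < s (last).
module A-join {a M} {s : Fin (suc (suc a)) → Fin (suc (suc M))} (s-mono : s Preserves _<_ ⟶ _<_)
              (E : Fin (suc M) → Embedding (AArc a) (AArc M)) where

  s-inject₁<s-last : ∀ p → s (inject₁ p) < s (fromℕ (suc a))
  s-inject₁<s-last p =
    s-mono (subst₂ ℕ._<_ (sym (toℕ-inject₁ p)) (sym (toℕ-fromℕ (suc a))) (toℕ<n p))

  t : Fin (suc a) → Fin (suc M)
  t p = lowerBelow (s-inject₁<s-last p)

  toℕ-t : ∀ p → toℕ (t p) ≡ toℕ (s (inject₁ p))
  toℕ-t p = toℕ-lowerBelow (s-inject₁<s-last p)

  t-mono : t Preserves _<_ ⟶ _<_
  t-mono {p} {q} p<q = subst₂ ℕ._<_ (sym (toℕ-t p)) (sym (toℕ-t q))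
    (s-mono (subst₂ ℕ._<_ (sym (toℕ-inject₁ p)) (sym (toℕ-inject₁ q)) p<q))

  f : AV (suc a) → AV (suc M)
  f (inj₁ (p , x)) = inj₁ (t p , to (E (t p)) x)
  f (inj₂ q)       = inj₂ (s q)

  f-injective : ∀ {x y} → f x ≡ f y → x ≡ y
  f-injective {inj₁ (p , x)} {inj₁ (q , y)} eq with ,-injective (inj₁-injective eq)
  ... | tp≡tq , ex≡ey = cong inj₁ (same-block (strictMono⇒injective t-mono tp≡tq) ex≡ey)
    where
    same-block : p ≡ q → to (E (t p)) x ≡ to (E (t q)) y → (p , x) ≡ (q , y)
    same-block refl ex≡ey = cong (p ,_) (injective (E (t p)) ex≡ey)
  f-injective {inj₂ p} {inj₂ q} eq = cong inj₂ (strictMono⇒injective s-mono (inj₂-injective eq))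

  f-homo : ∀ {x y} → AArc (suc a) x y → AArc (suc M) (f x) (f y)
  f-homo {inj₁ (p , _)} {inj₁ (q , _)} (inj₁ p<q)      = inj₁ (t-mono p<q)
  f-homo {inj₁ (p , _)} {inj₁ (p , _)} (inj₂ (refl , a)) = inj₂ (refl , homo (E (t p)) a)
  f-homo {inj₂ p}       {inj₂ q}       q<p             = s-mono q<p
  f-homo {inj₂ i}       {inj₁ (j , _)} i≤j             =
    ≤-trans (strictMono⇒mono s-mono (≤-trans i≤j (≤-reflexive (sym (toℕ-inject₁ j)))))
            (≤-reflexive (sym (toℕ-t j)))
  f-homo {inj₁ (j , _)} {inj₂ i}       j<i             =
    ≤-<-trans (≤-reflexive (toℕ-t j)) (s-mono (≤-<-trans (≤-reflexive (toℕ-inject₁ j)) j<i))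

  embedding : Embedding (AArc (suc a)) (AArc (suc M))
  embedding = record { to = f ; injective = λ {x} {y} → f-injective {x} {y} ; homo = λ {x} {y} → f-homo {x} {y} }

A-assemble : ∀ {a} (c : AV (suc m) → Bool) {β} → Selection (c ∘ inj₂) β (suc a) →
  (∀ i → ACopy (c ∘ to (A-block i)) β a) → ACopy c β (suc a)
A-assemble {a = zero}  c (s , _ , s-β) _ = vertex (inj₂ (s zero)) , λ _ → s-β zero
A-assemble {a = suc a} c (s , s-mono , s-β) copies = embedding , colour
  where
  open A-join s-mono (proj₁ ∘ copies)
  colour : ∀ x → c (f x) ≡ _
  colour (inj₁ (p , x)) = proj₂ (copies (t p)) x
  colour (inj₂ q)       = s-β q

∃⊎∀ : {P Q : Fin n → Set} → (∀ i → P i ⊎ Q i) → (∃[ i ] P i) ⊎ (∀ i → Q i)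
∃⊎∀ {zero}  _ = inj₂ λ ()
∃⊎∀ {suc n} h with h zero | ∃⊎∀ (h ∘ suc)
... | inj₁ p | _              = inj₁ (zero , p)
... | inj₂ _ | inj₁ (i , p)   = inj₁ (suc i , p)
... | inj₂ q | inj₂ q′        = inj₂ λ { zero → q ; (suc i) → q′ i }

A-ramsey : ∀ a b {M} → a + b ≤ M → (c : AV M → Bool) (β : Bool) → ACopy c β a ⊎ ACopy c (not β) b
A-ramsey zero    b       _ c β = inj₁ tt
A-ramsey (suc a) zero    _ c β = inj₂ tt
A-ramsey (suc a) (suc b) {suc M} a+b≤M c β with ∃⊎∀ in-block
  where
  in-block : ∀ i → (ACopy (c ∘ to (A-block i)) β (suc a) ⊎ ACopy (c ∘ to (A-block i)) (not β) (suc b))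
                 ⊎ (ACopy (c ∘ to (A-block i)) β a × ACopy (c ∘ to (A-block i)) (not β) b)
  in-block i with A-ramsey a (suc b) (s≤s⁻¹ a+b≤M) (c ∘ to (A-block i)) β
  ... | inj₂ copy = inj₁ (inj₂ copy)
  ... | inj₁ small
    with A-ramsey (suc a) b (subst (_≤ M) (+-suc a b) (s≤s⁻¹ a+b≤M)) (c ∘ to (A-block i)) β
  ...   | inj₁ copy  = inj₁ (inj₁ copy)
  ...   | inj₂ small′ = inj₂ (small , small′)
... | inj₁ (i , inj₁ copy) = inj₁ (ACopy-block {c = c} i copy)
... | inj₁ (i , inj₂ copy) = inj₂ (ACopy-block {c = c} i copy)
... | inj₂ small
  with monochromatic-selection (suc a) (suc b) (m≤n⇒m≤o+n 2 a+b≤M) (c ∘ inj₂) β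
...   | inj₁ selection = inj₁ (A-assemble c selection (proj₁ ∘ small))
...   | inj₂ selection = inj₂ (A-assemble c selection (proj₂ ∘ small))

module _ {M} {_≺_ : Rel (AV (suc M)) 0ℓ} (sto : IsStrictTotalOrder _≡_ _≺_) where
  open IsStrictTotalOrder sto using (_<?_; compare) renaming (trans to ≺-trans)

  A-increasing-clique : (∀ {i j} → i < j → inj₂ i ≺ inj₂ j) → HasClique (BEdge (AArc (suc M)) _≺_) (suc (suc M))
  A-increasing-clique v-increasing = inj₂ , v-adj
    where
    v-adj : ∀ i j → i ≢ j → BEdge (AArc (suc M)) _≺_ (inj₂ i) (inj₂ j)
    v-adj i j i≢j with <-cmpᶠ i j
    ... | tri< i<j _ _ = inj₁ (v-increasing i<j , i<j)
    ... | tri≈ _ i≡j _ = contradiction i≡j i≢j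
    ... | tri> _ _ j<i = inj₂ (v-increasing j<i , j<i)

  A-inversion-cone : suc n + suc n ≤ M → CliqueNumber≥ (AV n) (AArc n) k →
    ∀ {i j} → i < j → inj₂ j ≺ inj₂ i → HasClique (BEdge (AArc (suc M)) _≺_) (suc k)
  A-inversion-cone {n} 2n+2≤M ω≥k {i} {j} i<j vj≺vi
    with A-ramsey (suc n) (suc n) 2n+2≤M (λ y → does (to (A-block (lowerBelow i<j)) y <? inj₂ j)) true
  ... | inj₁ (e , below) =
    cone (A-block _ ∘ᴱ e) ω≥k sto (inj₂ i)
      (λ x → inj₂ (≺-trans (does-<?-true sto (below x)) vj≺vi , ≤-reflexive (sym (toℕ-lowerBelow i<j))))
  ... | inj₂ (e , above) =
    cone (A-block _ ∘ᴱ e) ω≥k sto (inj₂ j)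
      (λ x → inj₁ (does-<?-false sto (λ ()) (above x) , ≤-<-trans (≤-reflexive (toℕ-lowerBelow i<j)) i<j))

  A-clique-step : suc n + suc n ≤ M → k ≤ suc M → CliqueNumber≥ (AV n) (AArc n) k →
    HasClique (BEdge (AArc (suc M)) _≺_) (suc k)
  A-clique-step 2n+2≤M k≤M+1 ω≥k with any? (λ i → any? (λ j → (i <ᶠ? j) ×-dec (inj₂ j <? inj₂ i)))
  ... | yes (i , j , i<j , vj≺vi) = A-inversion-cone 2n+2≤M ω≥k i<j vj≺vi
  ... | no no-inversion =
    HasClique-≤ {adj = BEdge (AArc (suc M)) _≺_} (s≤s k≤M+1) (A-increasing-clique v-increasing)
    where
    v-increasing : ∀ {i j} → i < j → inj₂ i ≺ inj₂ j
    v-increasing {i} {j} i<j with compare (inj₂ i) (inj₂ j)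
    ... | tri< vi≺vj _ _ = vi≺vj
    ... | tri≈ _ vi≡vj _ = contradiction (inj₂-injective vi≡vj) (<⇒≢ i<j)
    ... | tri> _ _ vj≺vi = contradiction (i , j , i<j , vj≺vi) no-inversion

A-bound : ℕ → ℕ
A-bound zero    = 0
A-bound (suc k) = suc (suc (A-bound k) + suc (A-bound k) + k)

A-cliqueNumber≥ : ∀ k → CliqueNumber≥ (AV (A-bound k)) (AArc (A-bound k)) k
A-cliqueNumber≥ zero    = cliqueNumber≥-zero {T = AArc 0}
A-cliqueNumber≥ (suc k) _≺_ sto =
  A-clique-step sto (m≤m+n _ k) (m≤n⇒m≤1+n (m≤n+m k _)) (A-cliqueNumber≥ k)

lemma1p4 : ((k : ℕ) → ∃[ N ] ((n : ℕ) → N ≤ n → CliqueNumber≥ (AV n) (AArc n) k))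
         × ((k : ℕ) → ∃[ N ] ((n : ℕ) → N ≤ n → CliqueNumber≥ (DV n) (DArc n) k))
lemma1p4 =
    (λ k → A-bound k , cliqueNumber≥-upward (λ _ → A-block zero) (A-cliqueNumber≥ k)) ,
    λ k → D-bound k , cliqueNumber≥-upward (λ _ → D-left) (D-cliqueNumber≥ k)
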